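{- Let $G$ be a graph on $n$ vertices with girth at least $5$. Then $\Delta(\mathcal{R}(G))\le n-\gamma(G)$.
   Context: All graphs are finite, simple and undirected; $N(v)$ denotes the open neighbourhood of $v$. A set $S\subseteq V(G)$ is a dominating set if every vertex of $G$ is in $S$ or adjacent to a vertex of $S$; it is a minimal dominating set if no proper subset of $S$ is a dominating set. $\gamma(G)$ is the domination number (minimum size of a dominating set) and $\Delta$ denotes maximum degree. The reconfiguration graph $\mathcal{R}(G)$ has as vertex set the collection of all minimal dominating sets of $G$, and two minimal dominating sets $M_1,M_2$ are adjacent iff there is a vertex $v$ with either ($M_2\setminus M_1=\{v\}$ and $M_1\setminus M_2\subseteq N(v)$) or ($M_1\setminus M_2=\{v\}$ and $M_2\setminus M_1\subseteq N(v)$). Girth at least 5 means $G$ has no cycles of length 3 or 4. -}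

module Defs where

open import Data.Nat using (ℕ)
open import Data.Bool using (Bool; true; false)
open import Data.Fin using (Fin)
open import Data.Fin.Subset using (Subset; _∈_; _∉_; _⊆_; _⊂_; _─_; ⁅_⁆; ∣_∣)
open import Data.Vec using (tabulate)
open import Data.List using (List; length)
open import Data.List.Relation.Unary.All using (All)
open import Data.List.Relation.Unary.Unique.Propositional using (Unique)
open import Data.Product using (Σ; ∃; _×_)
open import Data.Sum using (_⊎_)
open import Relation.Nullary using (¬_)
open import Relation.Binary.PropositionalEquality using (_≡_)

record Graph (n : ℕ) : Set where
  field
    adj     : Fin n → Fin n → Bool
    symm    : ∀ u v → adj u v ≡ adj v u
    irrefl  : ∀ v → adj v v ≡ false

open Graph public

module _ {n : ℕ} (G : Graph n) where

  Adj : Fin n → Fin n → Set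
  Adj u v = adj G u v ≡ true

  N : Fin n → Subset n
  N v = tabulate (adj G v)

  TriangleFree : Set
  TriangleFree = ∀ a b c → Adj a b → Adj b c → ¬ Adj c a

  -- no cycle of length 4 (a b c d a, with the four vertices distinct;
  -- a ≠ b, b ≠ c, c ≠ d, d ≠ a follow from irreflexivity)
  C4Free : Set
  C4Free = ∀ a b c d → ¬ (a ≡ c) → ¬ (b ≡ d) →
           Adj a b → Adj b c → Adj c d → ¬ Adj d a

  GirthAtLeast5 : Set
  GirthAtLeast5 = TriangleFree × C4Free

  Dominating : Subset n → Set
  Dominating S = ∀ v → v ∈ S ⊎ (∃ λ u → u ∈ S × Adj u v)

  MinimalDominating : Subset n → Set
  MinimalDominating S = Dominating S × (∀ T → T ⊂ S → ¬ Dominating T)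

  IsDominationNumber : ℕ → Set
  IsDominationNumber g =
    (∃ λ S → Dominating S × ∣ S ∣ ≡ g) × (∀ S → Dominating S → g Data.Nat.≤ ∣ S ∣)

  RAdj : Subset n → Subset n → Set
  RAdj M₁ M₂ = ∃ λ v →
      (M₂ ─ M₁ ≡ ⁅ v ⁆ × M₁ ─ M₂ ⊆ N v)
    ⊎ (M₁ ─ M₂ ≡ ⁅ v ⁆ × M₂ ─ M₁ ⊆ N v)

  -- every vertex of R(G) has degree at most k:
  -- any list of pairwise distinct minimal dominating sets all adjacent
  -- (in R(G)) to a minimal dominating set M has length at most k
  MaxDegreeRAtMost : ℕ → Set
  MaxDegreeRAtMost k =
    ∀ M → MinimalDominating M →
    ∀ (L : List (Subset n)) → Unique L →
    All (λ M′ → MinimalDominating M′ × RAdj M M′) L →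
    length L Data.Nat.≤ k

-- Every neighbour M′ of a minimal dominating set M in R(G) contains a vertex
-- outside M.  In a graph of girth at least 5 two distinct neighbours of M
-- never share such a vertex w: if they did, their intersection would already
-- dominate G (a vertex z it misses would close a triangle or a 4-cycle through
-- w, or contradict the existence of a private neighbour of w), against
-- minimality.  So M has at most n − ∣M∣ ≤ n − γ(G) neighbours.
module Submission where

open import Defs
open import Data.Nat using (ℕ; _∸_; _≤_; z≤n; s≤s)
open import Data.Nat.Properties using (≤-trans; ∸-monoʳ-≤)
open import Data.Bool using (true)
import Data.Bool as Bool
open import Data.Fin using (Fin) renaming (_≟_ to _≟ᶠ_)
open import Data.Fin.Properties using (any?; ¬∀⟶∃¬)
open import Data.Fin.Subset using (Subset; _∈_; _∉_; _⊆_; _─_; _-_; ⁅_⁆; ∣_∣; _∩_; ∁; inside; outside)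
open import Data.Fin.Subset.Properties
  using ( _∈?_; x∈⁅x⁆; x∈⁅y⁆⇒x≡y; x∈p∧x∉q⇒x∈p─q; p─q⊆p; x∈p∧x≢y⇒x∈p-y; x∈p⇒p-x⊂p
        ; x∈p⇒∣p-x∣<∣p∣; x∈p∩q⁺; p∩q⊆p; p∩q⊆q; ⊆-trans; ⊆-antisym; x∉p⇒x∈∁p; ∣∁p∣≡n∸∣p∣)
open import Data.Vec using (_∷_; here; there)
open import Data.Vec.Properties using (lookup∘tabulate; []=⇒lookup)
open import Data.List using (List; length; _∷_; [])
open import Data.List.Membership.Propositional using () renaming (_∈_ to _∈ₗ_)
open import Data.List.Relation.Unary.Any using (here; there)
open import Data.List.Relation.Unary.All as All using (All)
open import Data.List.Relation.Unary.AllPairs using (_∷_)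
open import Data.List.Relation.Unary.Unique.Propositional using (Unique)
open import Data.Product using (∃; _×_; _,_; proj₁; proj₂)
open import Data.Sum using (_⊎_; inj₁; inj₂; [_,_]′)
open import Data.Empty using (⊥; ⊥-elim)
open import Relation.Nullary using (¬_; Dec; yes; no; contradiction)
open import Relation.Nullary.Decidable using (_×-dec_; _⊎-dec_; ¬?)
open import Function using (_∘′_)
open import Relation.Binary.PropositionalEquality using (_≡_; _≢_; refl; sym; trans; subst)

x∈p─q⇒x∉q : ∀ {n} {x : Fin n} (p q : Subset n) → x ∈ p ─ q → x ∉ q
x∈p─q⇒x∉q (_ ∷ p) (inside  ∷ q) ()        here
x∈p─q⇒x∉q (_ ∷ p) (outside ∷ q) here      ()
x∈p─q⇒x∉q (_ ∷ p) (_       ∷ q) (there i) (there j) = x∈p─q⇒x∉q p q i j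

p─q≡⁅v⁆⇒v∈p─q : ∀ {n} {p q : Subset n} {v : Fin n} → p ─ q ≡ ⁅ v ⁆ → v ∈ p ─ q
p─q≡⁅v⁆⇒v∈p─q {v = v} p─q≡⁅v⁆ = subst (v ∈_) (sym p─q≡⁅v⁆) (x∈⁅x⁆ v)

p─q≡⁅v⁆⇒≡v : ∀ {n} {p q : Subset n} {v x : Fin n} → p ─ q ≡ ⁅ v ⁆ → x ∈ p → x ∉ q → x ≡ v
p─q≡⁅v⁆⇒≡v {x = x} p─q≡⁅v⁆ x∈p x∉q = x∈⁅y⁆⇒x≡y _ (subst (x ∈_) p─q≡⁅v⁆ (x∈p∧x∉q⇒x∈p─q x∈p x∉q))

injection⇒length≤∣p∣ : ∀ {a} {A : Set a} {n} {xs : List A} (p : Subset n) → Unique xs →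
  (f : ∀ {x} → x ∈ₗ xs → Fin n) → (∀ {x} (i : x ∈ₗ xs) → f i ∈ p) →
  (∀ {x y} (i : x ∈ₗ xs) (j : y ∈ₗ xs) → f i ≡ f j → x ≡ y) →
  length xs ≤ ∣ p ∣
injection⇒length≤∣p∣ {xs = []}     p _                       f f∈p f-inj = z≤n
injection⇒length≤∣p∣ {xs = x ∷ xs} p (x∉xs ∷ xs-unique) f f∈p f-inj =
  ≤-trans (s≤s (injection⇒length≤∣p∣ (p - f₀) xs-unique (λ i → f (there i)) f∈p-f₀
                                       (λ i j → f-inj (there i) (there j))))
          (x∈p⇒∣p-x∣<∣p∣ (f∈p (here refl)))
  where
  f₀ : Fin _
  f₀ = f (here refl)
  f∈p-f₀ : ∀ {y} (i : y ∈ₗ xs) → f (there i) ∈ p - f₀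
  f∈p-f₀ i = x∈p∧x≢y⇒x∈p-y (f∈p (there i))
               (λ eq → All.lookup x∉xs i (f-inj (here refl) (there i) (sym eq)))

module _ {n : ℕ} (G : Graph n) where

  private
    variable
      M M′ M₁ M₂ Mᵢ Mⱼ S T : Subset n
      p u u₁ u₂ v w x y z : Fin n

  infix 4 _~_ _dominates_

  _~_ : Fin n → Fin n → Set
  u ~ v = Adj G u v

  ~-sym : u ~ v → v ~ u
  ~-sym {u} {v} u~v = trans (symm G v u) u~v

  ~-irrefl : ¬ v ~ v
  ~-irrefl {v} v~v = contradiction (trans (sym v~v) (irrefl G v)) λ ()

  _~?_ : ∀ u v → Dec (u ~ v)
  u ~? v = adj G u v Bool.≟ true

  ∈N⇒~ : x ∈ N G v → v ~ x
  ∈N⇒~ {x} {v} x∈Nv = trans (sym (lookup∘tabulate (adj G v) x)) ([]=⇒lookup x∈Nv)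

  _dominates_ : Fin n → Fin n → Set
  u dominates z = u ≡ z ⊎ u ~ z

  dominates⇒~ : w ~ p → ¬ w dominates z → p dominates z → p ~ z
  dominates⇒~ w~p w⋫z (inj₁ refl) = ⊥-elim (w⋫z (inj₂ w~p))
  dominates⇒~ w~p w⋫z (inj₂ p~z)  = p~z

  Dominated : Subset n → Fin n → Set
  Dominated S v = v ∈ S ⊎ ∃ λ u → u ∈ S × u ~ v

  dominated? : ∀ S v → Dec (Dominated S v)
  dominated? S v = (v ∈? S) ⊎-dec any? (λ u → (u ∈? S) ×-dec (u ~? v))

  dominated-by : u ∈ S → u dominates z → Dominated S z
  dominated-by u∈S (inj₁ refl) = inj₁ u∈S
  dominated-by u∈S (inj₂ u~z)  = inj₂ (_ , u∈S , u~z)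

  dominator : Dominating G S → ∀ z → ∃ λ u → u ∈ S × u dominates z
  dominator S-dom z with S-dom z
  ... | inj₁ z∈S           = z , z∈S , inj₁ refl
  ... | inj₂ (u , u∈S , u~z) = u , u∈S , inj₂ u~z

  minimal-⊆⇒⊇ : MinimalDominating G S → T ⊆ S → Dominating G T → S ⊆ T
  minimal-⊆⇒⊇ {T = T} (_ , S-min) T⊆S T-dom {x} x∈S with x ∈? T
  ... | yes x∈T = x∈T
  ... | no  x∉T = ⊥-elim (S-min T (T⊆S , x , x∈S , x∉T) T-dom)

  minimal-⊈ : Dominating G T → MinimalDominating G S → x ∈ S → x ∉ T → ∃ λ y → y ∈ T × y ∉ S
  minimal-⊈ {T} {S} T-dom S-min x∈S x∉T with any? (λ y → (y ∈? T) ×-dec ¬? (y ∈? S))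
  ... | yes witness = witness
  ... | no  T⊆S     = ⊥-elim (x∉T (minimal-⊆⇒⊇ S-min T⊆S′ T-dom x∈S))
    where
    T⊆S′ : T ⊆ S
    T⊆S′ {y} y∈T with y ∈? S
    ... | yes y∈S = y∈S
    ... | no  y∉S = ⊥-elim (T⊆S (y , y∈T , y∉S))

  private-neighbour : MinimalDominating G S → w ∈ S →
    ∃ λ q → w dominates q × (∀ {m} → m ∈ S → m dominates q → m ≡ w)
  private-neighbour {S} {w} (S-dom , S-min) w∈S
    with q , q-undominated ← ¬∀⟶∃¬ n (Dominated (S - w)) (dominated? (S - w))
                                 (S-min (S - w) (x∈p⇒p-x⊂p w∈S))
    = q , w▸q , unique-dominator
    where
    unique-dominator : ∀ {m} → m ∈ S → m dominates q → m ≡ w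
    unique-dominator {m} m∈S m▸q with m ≟ᶠ w
    ... | yes m≡w = m≡w
    ... | no  m≢w = ⊥-elim (q-undominated (dominated-by (x∈p∧x≢y⇒x∈p-y m∈S m≢w) m▸q))
    w▸q : w dominates q
    w▸q with u , u∈S , u▸q ← dominator S-dom q with refl ← unique-dominator u∈S u▸q = u▸q

  record Addition (M M′ : Subset n) (w : Fin n) : Set where
    field
      added   : ∀ {x} → x ∈ M′ → x ∉ M → x ≡ w
      dropped : ∀ {x} → x ∈ M → x ∉ M′ → w ~ x

  record Removal (M M′ : Subset n) (u : Fin n) : Set where
    field
      ∈-before : u ∈ M
      ∉-after  : u ∉ M′
      removed  : ∀ {x} → x ∈ M → x ∉ M′ → x ≡ u
      gained   : ∀ {x} → x ∈ M′ → x ∉ M → u ~ x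

  open Addition public
  open Removal public

  Step : Subset n → Subset n → Fin n → Set
  Step M M′ w = Addition M M′ w ⊎ ∃ (Removal M M′)

  RAdj⇒Step : RAdj G M M′ → w ∈ M′ → w ∉ M → Step M M′ w
  RAdj⇒Step {M} {M′} (v , inj₁ (M′─M≡⁅v⁆ , M─M′⊆Nv)) w∈M′ w∉M =
    inj₁ record { added = added′ ; dropped = dropped′ }
    where
    w≡v : _ ≡ v
    w≡v = p─q≡⁅v⁆⇒≡v M′─M≡⁅v⁆ w∈M′ w∉M
    added′ : x ∈ M′ → x ∉ M → x ≡ _
    added′ x∈M′ x∉M = trans (p─q≡⁅v⁆⇒≡v M′─M≡⁅v⁆ x∈M′ x∉M) (sym w≡v)
    dropped′ : x ∈ M → x ∉ M′ → _ ~ x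
    dropped′ x∈M x∉M′ = subst (_~ _) (sym w≡v) (∈N⇒~ (M─M′⊆Nv (x∈p∧x∉q⇒x∈p─q x∈M x∉M′)))
  RAdj⇒Step {M} {M′} (u , inj₂ (M─M′≡⁅u⁆ , M′─M⊆Nu)) _ _ = inj₂ (u , record
    { ∈-before = p─q⊆p M M′ u∈M─M′
    ; ∉-after  = x∈p─q⇒x∉q M M′ u∈M─M′
    ; removed  = p─q≡⁅v⁆⇒≡v M─M′≡⁅u⁆
    ; gained   = λ x∈M′ x∉M → ∈N⇒~ (M′─M⊆Nu (x∈p∧x∉q⇒x∈p─q x∈M′ x∉M))
    })
    where
    u∈M─M′ : u ∈ M ─ M′
    u∈M─M′ = p─q≡⁅v⁆⇒v∈p─q M─M′≡⁅u⁆

  RAdj⇒new-vertex : MinimalDominating G M → MinimalDominating G M′ → RAdj G M M′ →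
    ∃ λ w → w ∈ M′ × w ∉ M
  RAdj⇒new-vertex {M} {M′} _ _ (v , inj₁ (M′─M≡⁅v⁆ , _)) =
    v , p─q⊆p M′ M v∈M′─M , x∈p─q⇒x∉q M′ M v∈M′─M
    where
    v∈M′─M : v ∈ M′ ─ M
    v∈M′─M = p─q≡⁅v⁆⇒v∈p─q M′─M≡⁅v⁆
  RAdj⇒new-vertex {M} {M′} M-min M′-min (u , inj₂ (M─M′≡⁅u⁆ , _)) =
    minimal-⊈ (proj₁ M′-min) M-min (p─q⊆p M M′ u∈M─M′) (x∈p─q⇒x∉q M M′ u∈M─M′)
    where
    u∈M─M′ : u ∈ M ─ M′
    u∈M─M′ = p─q≡⁅v⁆⇒v∈p─q M─M′≡⁅u⁆

  dominator∈M : (∀ {x} → x ∈ M′ → x ∉ M → x ≡ w) → ¬ w dominates z →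
    p ∈ M′ → p dominates z → p ∈ M
  dominator∈M {M = M} {p = p} only-w-added w⋫z p∈M′ p▸z with p ∈? M
  ... | yes p∈M = p∈M
  ... | no  p∉M = ⊥-elim (w⋫z (subst (_dominates _) (only-w-added p∈M′ p∉M) p▸z))

  removal-keeps : Removal M M′ u → x ∈ M → x ≢ u → x ∈ M′
  removal-keeps {M′ = M′} {x = x} R x∈M x≢u with x ∈? M′
  ... | yes x∈M′ = x∈M′
  ... | no  x∉M′ = ⊥-elim (x≢u (removed R x∈M x∉M′))

  module _ (girth : GirthAtLeast5 G) where

    private
      no-triangle : ∀ {a b c} → a ~ b → b ~ c → c ~ a → ⊥
      no-triangle = proj₁ girth _ _ _

      no-square : ∀ {a b c d} → a ≢ c → b ≢ d → a ~ b → b ~ c → c ~ d → d ~ a → ⊥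
      no-square = proj₂ girth _ _ _ _

    -- The private neighbour q of w in M′ is neither w (y dominates it), nor u
    -- (z does), nor anything else (its dominator in M is u, closing a triangle w q u).
    no-private-neighbour : Dominating G M → MinimalDominating G M′ →
      (∀ {x} → x ∈ M → x ∉ M′ → x ≡ u) → w ∈ M′ → w ∉ M → w ~ u →
      y ∈ M′ → y ~ w → z ∈ M′ → z ~ u → z ≢ w → ⊥
    no-private-neighbour {M} {M′} {u} M-dom M′-min only-u-removed w∈M′ w∉M w~u y∈M′ y~w z∈M′ z~u z≢w
      with private-neighbour M′-min w∈M′
    ... | _ , inj₁ refl , unique-dominator with refl ← unique-dominator y∈M′ (inj₂ y~w) = ~-irrefl y~w
    ... | q , inj₂ w~q , unique-dominator with q ≟ᶠ u
    ...   | yes refl = z≢w (unique-dominator z∈M′ (inj₂ z~u))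
    ...   | no  q≢u with m , m∈M , m▸q ← dominator M-dom q | m ∈? M′
    ...     | yes m∈M′ = w∉M (subst (_∈ M) (unique-dominator m∈M′ m▸q) m∈M)
    ...     | no  m∉M′ =
                [ (λ u≡q → q≢u (sym u≡q)) , (λ u~q → no-triangle w~q (~-sym u~q) (~-sym w~u)) ]′
                  (subst (_dominates q) (only-u-removed m∈M m∉M′) m▸q)

    removal-dominator≡ : Removal M Mᵢ u → Removal M Mⱼ u → u ~ z →
      p ∈ Mᵢ → p ∉ Mⱼ → p dominates z → p ≡ z
    removal-dominator≡ Rᵢ Rⱼ u~z p∈Mᵢ p∉Mⱼ (inj₁ p≡z) = p≡z
    removal-dominator≡ {M} {Mᵢ} {p = p} Rᵢ Rⱼ u~z p∈Mᵢ p∉Mⱼ (inj₂ p~z) with p ∈? M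
    ... | yes p∈M = ⊥-elim (∉-after Rᵢ (subst (_∈ Mᵢ) (removed Rⱼ p∈M p∉Mⱼ) p∈Mᵢ))
    ... | no  p∉M = ⊥-elim (no-triangle (gained Rᵢ p∈Mᵢ p∉M) p~z (~-sym u~z))

    module TwoNeighbours {M M₁ M₂ : Subset n} (M-min : MinimalDominating G M)
        (M₁-min : MinimalDominating G M₁) (M₂-min : MinimalDominating G M₂)
        {w} (w∈M₁ : w ∈ M₁) (w∈M₂ : w ∈ M₂) (w∉M : w ∉ M)
        {z} (undominated : ∀ {v} → v ∈ M₁ → v dominates z → v ∉ M₂) where

      undominated′ : v ∈ M₂ → v dominates z → v ∉ M₁
      undominated′ v∈M₂ v▸z v∈M₁ = undominated v∈M₁ v▸z v∈M₂

      w⋫z : ¬ w dominates z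
      w⋫z w▸z = undominated w∈M₁ w▸z w∈M₂

      z≢w : z ≢ w
      z≢w z≡w = w⋫z (inj₁ (sym z≡w))

      removed~z : Removal M Mᵢ u → w ∈ Mᵢ → u dominates z → u ~ z
      removed~z R w∈Mᵢ = dominates⇒~ (~-sym (gained R w∈Mᵢ w∉M)) w⋫z

      add-add : Addition M M₁ w → Addition M M₂ w → ⊥
      add-add A₁ A₂
        with p , p∈M₁ , p▸z ← dominator (proj₁ M₁-min) z
           | r , r∈M₂ , r▸z ← dominator (proj₁ M₂-min) z =
        no-square (z≢w ∘′ sym) p≢r w~p (dominates⇒~ w~p w⋫z p▸z)
                  (~-sym (dominates⇒~ w~r w⋫z r▸z)) (~-sym w~r)
        where
        r∉M₁ : r ∉ M₁
        r∉M₁ = undominated′ r∈M₂ r▸z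
        w~p : w ~ p
        w~p = dropped A₂ (dominator∈M (added A₁) w⋫z p∈M₁ p▸z) (undominated p∈M₁ p▸z)
        w~r : w ~ r
        w~r = dropped A₁ (dominator∈M (added A₂) w⋫z r∈M₂ r▸z) r∉M₁
        p≢r : p ≢ r
        p≢r refl = r∉M₁ p∈M₁

      add-remove : Addition M M₁ w → Removal M M₂ u → ⊥
      add-remove {u} A₁ R₂ = from-dominator-in-M₂ (dominator (proj₁ M₂-min) z)
        where
        u-dominates-z-from-M₁ : u ∈ M₁ × u dominates z
        u-dominates-z-from-M₁
          with p , p∈M₁ , p▸z ← dominator (proj₁ M₁-min) z
          with refl ← removed R₂ (dominator∈M (added A₁) w⋫z p∈M₁ p▸z) (undominated p∈M₁ p▸z)
          = p∈M₁ , p▸z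
        u∈M₁ : u ∈ M₁
        u∈M₁ = proj₁ u-dominates-z-from-M₁
        u~w : u ~ w
        u~w = gained R₂ w∈M₂ w∉M
        u~z : u ~ z
        u~z = removed~z R₂ w∈M₂ (proj₂ u-dominates-z-from-M₁)

        from-dominator-in-M₂ : (∃ λ r → r ∈ M₂ × r dominates z) → ⊥
        from-dominator-in-M₂ (r , r∈M₂ , r▸z) with r ∈? M
        ... | yes r∈M =
          no-square (z≢w ∘′ sym) u≢r (~-sym u~w) u~z (~-sym (dominates⇒~ w~r w⋫z r▸z)) (~-sym w~r)
          where
          r∉M₁ : r ∉ M₁
          r∉M₁ = undominated′ r∈M₂ r▸z
          w~r : w ~ r
          w~r = dropped A₁ r∈M r∉M₁
          u≢r : u ≢ r
          u≢r refl = r∉M₁ u∈M₁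
        ... | no r∉M with r▸z
        ...   | inj₂ r~z = no-triangle (gained R₂ r∈M₂ r∉M) r~z (~-sym u~z)
        ...   | inj₁ refl with x , x∈M , x∉M₁ ← minimal-⊈ (proj₁ M-min) M₁-min w∈M₁ w∉M =
          no-private-neighbour (proj₁ M-min) M₂-min (removed R₂) w∈M₂ w∉M (~-sym u~w)
            (removal-keeps R₂ x∈M (λ { refl → x∉M₁ u∈M₁ })) (~-sym (dropped A₁ x∈M x∉M₁))
            r∈M₂ (~-sym u~z) z≢w

      removal-dominates : Removal M M₁ u₁ → Removal M M₂ u₂ → u₁ dominates z ⊎ u₂ dominates z
      removal-dominates R₁ R₂ with m , m∈M , m▸z ← dominator (proj₁ M-min) z | m ∈? M₁
      ... | no  m∉M₁ = inj₁ (subst (_dominates z) (removed R₁ m∈M m∉M₁) m▸z)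
      ... | yes m∈M₁ = inj₂ (subst (_dominates z) (removed R₂ m∈M (undominated m∈M₁ m▸z)) m▸z)

      same-removal : Removal M M₁ u → Removal M M₂ u → u dominates z → ⊥
      same-removal R₁ R₂ u▸z
        with p , p∈M₁ , p▸z ← dominator (proj₁ M₁-min) z
           | r , r∈M₂ , r▸z ← dominator (proj₁ M₂-min) z
        with refl ← removal-dominator≡ R₁ R₂ (removed~z R₁ w∈M₁ u▸z) p∈M₁ (undominated p∈M₁ p▸z) p▸z
           | refl ← removal-dominator≡ R₂ R₁ (removed~z R₁ w∈M₁ u▸z) r∈M₂ (undominated′ r∈M₂ r▸z) r▸z
        = undominated p∈M₁ (inj₁ refl) r∈M₂

      distinct-removals : Removal M M₁ u₁ → Removal M M₂ u₂ → u₁ ≢ u₂ → u₁ dominates z → ⊥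
      distinct-removals {u₁} {u₂} R₁ R₂ u₁≢u₂ u₁▸z = from-dominator-in-M₁ (dominator (proj₁ M₁-min) z)
        where
        u₁~w : u₁ ~ w
        u₁~w = gained R₁ w∈M₁ w∉M
        u₁~z : u₁ ~ z
        u₁~z = removed~z R₁ w∈M₁ u₁▸z

        from-dominator-in-M₁ : (∃ λ p → p ∈ M₁ × p dominates z) → ⊥
        from-dominator-in-M₁ (p , p∈M₁ , p▸z) with p ∈? M
        ... | yes p∈M with refl ← removed R₂ p∈M (undominated p∈M₁ p▸z) =
          no-square (z≢w ∘′ sym) u₁≢u₂ (~-sym u₁~w) u₁~z (~-sym (removed~z R₂ w∈M₂ p▸z)) (gained R₂ w∈M₂ w∉M)
        ... | no p∉M with p▸z
        ...   | inj₂ p~z = no-triangle (gained R₁ p∈M₁ p∉M) p~z (~-sym u₁~z)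
        ...   | inj₁ refl =
          no-private-neighbour (proj₁ M-min) M₁-min (removed R₁) w∈M₁ w∉M (~-sym u₁~w)
            (removal-keeps R₁ (∈-before R₂) (u₁≢u₂ ∘′ sym)) (gained R₂ w∈M₂ w∉M) p∈M₁ (~-sym u₁~z) z≢w

    ∩-dominating : MinimalDominating G M → MinimalDominating G M₁ → MinimalDominating G M₂ →
      Step M M₁ w → Step M M₂ w → w ∈ M₁ → w ∈ M₂ → w ∉ M → Dominating G (M₁ ∩ M₂)
    ∩-dominating {M} {M₁} {M₂} {w} M-min M₁-min M₂-min S₁ S₂ w∈M₁ w∈M₂ w∉M z
      with dominated? (M₁ ∩ M₂) z
    ... | yes z-dominated = z-dominated
    ... | no  z-undominated = ⊥-elim (cases S₁ S₂)
      where
      undominated : v ∈ M₁ → v dominates z → v ∉ M₂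
      undominated v∈M₁ v▸z v∈M₂ = z-undominated (dominated-by (x∈p∩q⁺ (v∈M₁ , v∈M₂)) v▸z)
      open TwoNeighbours M-min M₁-min M₂-min w∈M₁ w∈M₂ w∉M undominated
      module Swapped = TwoNeighbours M-min M₂-min M₁-min w∈M₂ w∈M₁ w∉M undominated′
      cases : Step M M₁ w → Step M M₂ w → ⊥
      cases (inj₁ A₁)        (inj₁ A₂)        = add-add A₁ A₂
      cases (inj₁ A₁)        (inj₂ (_ , R₂))  = add-remove A₁ R₂
      cases (inj₂ (_ , R₁))  (inj₁ A₂)        = Swapped.add-remove A₂ R₁
      cases (inj₂ (u₁ , R₁)) (inj₂ (u₂ , R₂)) with u₁ ≟ᶠ u₂
      ... | yes refl = [ same-removal R₁ R₂ , same-removal R₁ R₂ ]′ (removal-dominates R₁ R₂)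
      ... | no u₁≢u₂ =
        [ distinct-removals R₁ R₂ u₁≢u₂ , Swapped.distinct-removals R₂ R₁ (u₁≢u₂ ∘′ sym) ]′
          (removal-dominates R₁ R₂)

    shared-new-vertex⇒≡ : MinimalDominating G M → MinimalDominating G M₁ → MinimalDominating G M₂ →
      RAdj G M M₁ → RAdj G M M₂ → w ∈ M₁ → w ∈ M₂ → w ∉ M → M₁ ≡ M₂
    shared-new-vertex⇒≡ {M₁ = M₁} {M₂} M-min M₁-min M₂-min M~M₁ M~M₂ w∈M₁ w∈M₂ w∉M =
      ⊆-antisym (⊆-trans (minimal-⊆⇒⊇ M₁-min (p∩q⊆p M₁ M₂) ∩-dom) (p∩q⊆q M₁ M₂))
                (⊆-trans (minimal-⊆⇒⊇ M₂-min (p∩q⊆q M₁ M₂) ∩-dom) (p∩q⊆p M₁ M₂))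
      where
      ∩-dom : Dominating G (M₁ ∩ M₂)
      ∩-dom = ∩-dominating M-min M₁-min M₂-min
                (RAdj⇒Step M~M₁ w∈M₁ w∉M) (RAdj⇒Step M~M₂ w∈M₂ w∉M) w∈M₁ w∈M₂ w∉M

    R-degree≤ : MinimalDominating G M → (L : List (Subset n)) → Unique L →
      All (λ M′ → MinimalDominating G M′ × RAdj G M M′) L → length L ≤ n ∸ ∣ M ∣
    R-degree≤ {M} M-min L L-unique L-nbrs =
      subst (length L ≤_) (∣∁p∣≡n∸∣p∣ M)
        (injection⇒length≤∣p∣ (∁ M) L-unique new new∈∁M new-injective)
      where
      neighbour : ∀ {M′} → M′ ∈ₗ L → MinimalDominating G M′ × RAdj G M M′
      neighbour = All.lookup L-nbrs
      new-vertex : ∀ {M′} → M′ ∈ₗ L → ∃ λ w → w ∈ M′ × w ∉ M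
      new-vertex i = RAdj⇒new-vertex M-min (proj₁ (neighbour i)) (proj₂ (neighbour i))
      new : ∀ {M′} → M′ ∈ₗ L → Fin n
      new i = proj₁ (new-vertex i)
      new∈∁M : ∀ {M′} (i : M′ ∈ₗ L) → new i ∈ ∁ M
      new∈∁M i = x∉p⇒x∈∁p (proj₂ (proj₂ (new-vertex i)))
      new-injective : ∀ {M₁ M₂} (i : M₁ ∈ₗ L) (j : M₂ ∈ₗ L) → new i ≡ new j → M₁ ≡ M₂
      new-injective {M₂ = M₂} i j new-i≡new-j =
        shared-new-vertex⇒≡ M-min (proj₁ (neighbour i)) (proj₁ (neighbour j))
          (proj₂ (neighbour i)) (proj₂ (neighbour j))
          (proj₁ (proj₂ (new-vertex i)))
          (subst (_∈ M₂) (sym new-i≡new-j) (proj₁ (proj₂ (new-vertex j))))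
          (proj₂ (proj₂ (new-vertex i)))

theorem14 : ∀ (n : ℕ) (G : Graph n) → GirthAtLeast5 G →
    ∀ (g : ℕ) → IsDominationNumber G g →
    MaxDegreeRAtMost G (n ∸ g)
theorem14 n G girth g (_ , γ-minimum) M M-min L L-unique L-nbrs =
  ≤-trans (R-degree≤ G girth M-min L L-unique L-nbrs) (∸-monoʳ-≤ n (γ-minimum M (proj₁ M-min)))
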